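{- Let $R$ be a commutative ring with unit, $d$ a positive integer, and $0\le q\le d+1$. With $\pi^*$, $s^*$, $K$ and $D$ as in the context, on $\Omega^q(\mathbb{N}^{d+1})$ we have $$\mathrm{Id}-\pi^*\circ s^*=DK+KD.$$
   Context: $\mathbb{N}=\{1,2,\dots\}$. For $m\ge1$, $\Omega^q(\mathbb{N}^m)$ is the $q$-th exterior power over the ring of maps $\mathbb{N}^m\to R$ of the free module with basis $dx_1,\dots,dx_m$; elements are uniquely $\sum_I f_I\,dx_I$, where for $I=\{i_1<\dots<i_q\}$, $dx_I=dx_{i_1}\wedge\cdots\wedge dx_{i_q}$. $\partial_if(n)=f(n+e_i)-f(n)$. $D:\Omega^q\to\Omega^{q+1}$ is $D(\sum_I f_I dx_I)=\sum_I(\sum_j\partial_jf_I\,dx_j)\wedge dx_I$ (and $D=0$ on $\Omega^{m}(\mathbb{N}^m)$). Write points of $\mathbb{N}^{d+1}$ as $(n_1,\dots,n_d,t)$. Define $\pi^*:\Omega^q(\mathbb{N}^d)\to\Omega^q(\mathbb{N}^{d+1})$ by $\pi^*(f\,dx_I)=f(n_1,\dots,n_d)\,dx_I$ (viewed as a function of $(n_1,\dots,n_d,t)$), and $s^*:\Omega^q(\mathbb{N}^{d+1})\to\Omega^q(\mathbb{N}^d)$ by $s^*(f\,dx_I)=f(n_1,\dots,n_d,1)\,dx_I$ if $d+1\notin I$ and $s^*(f\,dx_I)=0$ if $d+1\in I$, both extended additively. Every $\omega\in\Omega^q(\mathbb{N}^{d+1})$ is uniquely $\sum_{I\subset\{1..d\},|I|=q}f_I\,dx_I+\sum_{J\subset\{1..d\},|J|=q-1}g_J\,dx_{d+1}\wedge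 dx_J$; define $K:\Omega^q(\mathbb{N}^{d+1})\to\Omega^{q-1}(\mathbb{N}^{d+1})$ by $K(\omega)=\sum_J\big(\sum_{k=1}^{t-1}g_J(n_1,\dots,n_d,k)\big)dx_J$ (so $K$ kills terms without $dx_{d+1}$; $K=0$ on $\Omega^0$). -}

module Defs where


open import Algebra.Bundles using (CommutativeRing)
open import Data.Nat using (ℕ; zero; suc; _∸_; _≤_)
open import Data.Fin using (Fin; zero; suc; fromℕ)
open import Data.Bool using (Bool; true; false; if_then_else_)
open import Data.Vec using (Vec; []; _∷_; lookup; updateAt; _[_]≔_; _∷ʳ_; init; last)
open import Data.Vec.Relation.Unary.All using (All)
open import Data.Fin.Subset using (Subset; ∣_∣)
open import Relation.Binary.PropositionalEquality using (_≡_)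
open import Relation.Nullary using (¬_)

-- Points of ℕ^m are vectors of naturals; the paper's ℕ = {1,2,...} is the set of
-- points all of whose coordinates are ≥ 1 (see 'Positive').  Forms are stored as
-- functions on all of Vec ℕ m, but every operator below evaluated at a positive point
-- only consults positive points, and all statements are made at positive points only.
Pt : ℕ → Set
Pt m = Vec ℕ m

Positive : ∀ {m} → Pt m → Set
Positive = All (1 ≤_)

shift : ∀ {m} → Fin m → Pt m → Pt m
shift i n = updateAt n i suc

countBelow : ∀ {m} → Fin m → Subset m → ℕ
countBelow zero    _       = 0
countBelow (suc j) (b ∷ J) = (if b then 1 else 0) Data.Nat.+ countBelow j J

module _ {c ℓ} (R : CommutativeRing c ℓ) where
  open CommutativeRing R using (Carrier; _≈_; _+_; _*_; -_; _-_; 0#; 1#)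

  sgn : ℕ → Carrier
  sgn zero    = 1#
  sgn (suc k) = - sgn k

  sumFin : ∀ {m} → (Fin m → Carrier) → Carrier
  sumFin {zero}  f = 0#
  sumFin {suc m} f = f zero + sumFin (λ j → f (suc j))

  sum1to : ℕ → (ℕ → Carrier) → Carrier
  sum1to zero    f = 0#
  sum1to (suc t) f = sum1to t f + f (suc t)

  -- A (not necessarily homogeneous) form on ℕ^m: ω = Σ_I (ω I) dx_I, where the
  -- subset I ⊆ {1..m} is a Vec Bool m and dx_I = dx_{i1} ∧ ... ∧ dx_{iq} (i1 < ... < iq).
  Form : ℕ → Set c
  Form m = Subset m → Pt m → Carrier

  HasDegree : ∀ {m} → ℕ → Form m → Set ℓ
  HasDegree {m} q ω = ∀ (I : Subset m) → ¬ (∣ I ∣ ≡ q)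
                       → ∀ (n : Pt m) → Positive n → ω I n ≈ 0#

  _⊕_ : ∀ {m} → Form m → Form m → Form m
  (ω ⊕ η) I n = ω I n + η I n

  _⊖_ : ∀ {m} → Form m → Form m → Form m
  (ω ⊖ η) I n = ω I n - η I n

  ∂ : ∀ {m} → Fin m → Form m → Form m
  ∂ i ω I n = ω I (shift i n) - ω I n

  -- dx_j ∧ ω, using dx_j ∧ dx_{J∖{j}} = (-1)^{#{i∈J : i<j}} dx_J for j ∈ J
  dx∧ : ∀ {m} → Fin m → Form m → Form m
  dx∧ j ω J n = if lookup J j then sgn (countBelow j J) * ω (J [ j ]≔ false) n else 0#

  D : ∀ {m} → Form m → Form m
  D ω J n = sumFin (λ j → dx∧ j (∂ j ω) J n)

  π* : ∀ {d} → Form d → Form (suc d)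
  π* ω I p = if last I then 0# else ω (init I) (init p)

  s* : ∀ {d} → Form (suc d) → Form d
  s* ω I n = ω (I ∷ʳ false) (n ∷ʳ 1)

  -- g_J, the coefficient of dx_{d+1} ∧ dx_J (J ⊆ {1..d}) in ω
  gCoeff : ∀ {d} → Form (suc d) → Subset d → Pt (suc d) → Carrier
  gCoeff {d} ω J p = sgn (countBelow (fromℕ d) (J ∷ʳ true)) * ω (J ∷ʳ true) p

  K : ∀ {d} → Form (suc d) → Form (suc d)
  K ω I p = if last I then 0#
            else sum1to (last p ∸ 1) (λ k → gCoeff ω (init I) (init p ∷ʳ k))

{-# OPTIONS --safe #-}

-- Write a coefficient index as J or J ∪ {d+1} and a point as (n, t), and let
-- f_J(n,t), g_J(n,t) be the coefficients of dx_J and dx_{d+1} ∧ dx_J.  On the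
-- dx_{d+1} ∧ dx_J component only the t-difference of K ω survives in D K ω, and
-- Δ_t Σ_{k<t} g_J(n,k) = g_J(n,t).  On the dx_J component, the g-coefficient of D ω is
-- Δ_t f_J minus the horizontal differential of g (multiplication by the sign (-1)^|J|
-- carried by dx_{d+1} ∧ dx_J anticommutes with D), so the horizontal parts of D K ω and K D ω
-- cancel and what remains telescopes to f_J(n,t) - f_J(n,1) = ((Id - π* s*) ω)_J(n,t).

module Submission where

open import Defs
open import Level using (Level)
open import Algebra.Bundles using (CommutativeRing)
open import Data.Nat using (ℕ; zero; suc; _≤_)
open import Data.Fin.Subset using (Subset; ∣_∣)
open import Data.Fin using (Fin; zero; suc; fromℕ; inject₁)
open import Data.Bool using (Bool; true; false; if_then_else_)
open import Data.Vec using (Vec; []; _∷_; lookup; updateAt; _[_]≔_; _∷ʳ_; initLast)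
open import Data.Vec.Properties using (init-∷ʳ; last-∷ʳ)
open import Data.Vec.Relation.Unary.All.Properties using (lookup⁺)
open import Data.Product using (_,_; ∃₂)
open import Relation.Binary.PropositionalEquality using (_≡_; refl; cong; cong₂; subst)

module _ {a} {A : Set a} where

  lookup-∷ʳ-inject₁ : ∀ {n} (xs : Vec A n) y i → lookup (xs ∷ʳ y) (inject₁ i) ≡ lookup xs i
  lookup-∷ʳ-inject₁ (x ∷ xs) y zero    = refl
  lookup-∷ʳ-inject₁ (x ∷ xs) y (suc i) = lookup-∷ʳ-inject₁ xs y i

  lookup-∷ʳ-fromℕ : ∀ {n} (xs : Vec A n) y → lookup (xs ∷ʳ y) (fromℕ n) ≡ y
  lookup-∷ʳ-fromℕ {zero}  []       y = refl
  lookup-∷ʳ-fromℕ {suc n} (x ∷ xs) y = lookup-∷ʳ-fromℕ xs y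

  updateAt-∷ʳ-inject₁ : ∀ {n} (xs : Vec A n) y i f →
                        updateAt (xs ∷ʳ y) (inject₁ i) f ≡ updateAt xs i f ∷ʳ y
  updateAt-∷ʳ-inject₁ (x ∷ xs) y zero    f = refl
  updateAt-∷ʳ-inject₁ (x ∷ xs) y (suc i) f = cong (x ∷_) (updateAt-∷ʳ-inject₁ xs y i f)

  updateAt-∷ʳ-fromℕ : ∀ {n} (xs : Vec A n) y f → updateAt (xs ∷ʳ y) (fromℕ n) f ≡ xs ∷ʳ f y
  updateAt-∷ʳ-fromℕ {zero}  []       y f = refl
  updateAt-∷ʳ-fromℕ {suc n} (x ∷ xs) y f = cong (x ∷_) (updateAt-∷ʳ-fromℕ xs y f)

countBelow-∷ʳ-inject₁ : ∀ {d} (J : Subset d) b j → countBelow (inject₁ j) (J ∷ʳ b) ≡ countBelow j J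
countBelow-∷ʳ-inject₁ (x ∷ J) b zero    = refl
countBelow-∷ʳ-inject₁ (x ∷ J) b (suc j) =
  cong ((if x then 1 else 0) Data.Nat.+_) (countBelow-∷ʳ-inject₁ J b j)

countBelow-∷ʳ-fromℕ : ∀ {d} (J : Subset d) b → countBelow (fromℕ d) (J ∷ʳ b) ≡ ∣ J ∣
countBelow-∷ʳ-fromℕ {zero}  []          b = refl
countBelow-∷ʳ-fromℕ {suc d} (true ∷ J)  b = cong suc (countBelow-∷ʳ-fromℕ J b)
countBelow-∷ʳ-fromℕ {suc d} (false ∷ J) b = countBelow-∷ʳ-fromℕ J b

∣J∣≡suc∣J[j]≔false∣ : ∀ {d} (J : Subset d) j → lookup J j ≡ true → ∣ J ∣ ≡ suc ∣ J [ j ]≔ false ∣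
∣J∣≡suc∣J[j]≔false∣ (true ∷ J)  zero    refl = refl
∣J∣≡suc∣J[j]≔false∣ (true ∷ J)  (suc j) J[j] = cong suc (∣J∣≡suc∣J[j]≔false∣ J j J[j])
∣J∣≡suc∣J[j]≔false∣ (false ∷ J) (suc j) J[j] = ∣J∣≡suc∣J[j]≔false∣ J j J[j]

last-positive : ∀ {d} (n : Pt d) t → Positive (n ∷ʳ t) → 1 ≤ t
last-positive {d} n t pos = subst (1 ≤_) (lookup-∷ʳ-fromℕ n t) (lookup⁺ pos (fromℕ d))

module _ {c ℓ} (R : CommutativeRing c ℓ) where
  open CommutativeRing R hiding (zero) renaming (refl to ≈-refl; sym to ≈-sym; trans to ≈-trans)
  open import Relation.Binary.Reasoning.Setoid setoid
  open import Algebra.Properties.Ring ring using (-‿distribˡ-*; -‿distribʳ-*; x[y-z]≈xy-xz)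
  open import Algebra.Properties.AbelianGroup +-abelianGroup using (⁻¹-involutive; ⁻¹-∙-comm; ε⁻¹≈ε)
  open import Algebra.Properties.CommutativeSemigroup +-commutativeSemigroup using (interchange)
  open import Algebra.Properties.CommutativeSemigroup *-commutativeSemigroup using (x∙yz≈y∙xz)
  open import Algebra.Properties.Semiring.Sum semiring
    using (sum; sum-cong-≋; sum-replicate-zero; sum-init-last; ∑-distrib-+; *-distribˡ-sum)

  [x+y]-[u+v]≈[x-u]+[y-v] : ∀ x y u v → (x + y) - (u + v) ≈ (x - u) + (y - v)
  [x+y]-[u+v]≈[x-u]+[y-v] x y u v = begin
    (x + y) - (u + v)     ≈⟨ +-congˡ (⁻¹-∙-comm u v) ⟨
    (x + y) + (- u - v)   ≈⟨ interchange x y (- u) (- v) ⟩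
    (x - u) + (y - v)     ∎

  [y-x]+[z-y]≈z-x : ∀ x y z → (y - x) + (z - y) ≈ z - x
  [y-x]+[z-y]≈z-x x y z = begin
    (y - x) + (z - y)     ≈⟨ +-comm (y - x) (z - y) ⟩
    (z - y) + (y - x)     ≈⟨ +-assoc z (- y) (y - x) ⟩
    z + (- y + (y - x))   ≈⟨ +-congˡ (+-assoc (- y) y (- x)) ⟨
    z + ((- y + y) - x)   ≈⟨ +-congˡ (+-congʳ (-‿inverseˡ y)) ⟩
    z + (0# - x)          ≈⟨ +-congˡ (+-identityˡ (- x)) ⟩
    z - x                 ∎

  x+[y-x]≈y : ∀ x y → x + (y - x) ≈ y
  x+[y-x]≈y x y = begin
    x + (y - x)   ≈⟨ +-comm x (y - x) ⟩
    (y - x) + x   ≈⟨ +-assoc y (- x) x ⟩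
    y + (- x + x) ≈⟨ +-congˡ (-‿inverseˡ x) ⟩
    y + 0#        ≈⟨ +-identityʳ y ⟩
    y             ∎

  [x+y]-x≈y : ∀ x y → (x + y) - x ≈ y
  [x+y]-x≈y x y = begin
    (x + y) - x   ≈⟨ +-congʳ (+-comm x y) ⟩
    (y + x) - x   ≈⟨ +-assoc y x (- x) ⟩
    y + (x - x)   ≈⟨ +-congˡ (-‿inverseʳ x) ⟩
    y + 0#        ≈⟨ +-identityʳ y ⟩
    y             ∎

  sgn-suc-suc : ∀ k → sgn R (suc (suc k)) ≈ sgn R k
  sgn-suc-suc k = ⁻¹-involutive (sgn R k)

  sgn-idem : ∀ k → sgn R k * sgn R k ≈ 1#
  sgn-idem zero    = *-identityˡ 1#
  sgn-idem (suc k) = begin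
    - sgn R k * - sgn R k     ≈⟨ -‿distribˡ-* (sgn R k) (- sgn R k) ⟨
    - (sgn R k * - sgn R k)   ≈⟨ -‿cong (-‿distribʳ-* (sgn R k) (sgn R k)) ⟨
    - - (sgn R k * sgn R k)   ≈⟨ ⁻¹-involutive _ ⟩
    sgn R k * sgn R k         ≈⟨ sgn-idem k ⟩
    1#                        ∎

  sgn-cancel : ∀ k x → sgn R k * (sgn R k * x) ≈ x
  sgn-cancel k x = begin
    sgn R k * (sgn R k * x)   ≈⟨ *-assoc _ _ x ⟨
    (sgn R k * sgn R k) * x   ≈⟨ *-congʳ (sgn-idem k) ⟩
    1# * x                    ≈⟨ *-identityˡ x ⟩
    x                         ∎

  if-cong : ∀ b {x y} → (b ≡ true → x ≈ y) → (if b then x else 0#) ≈ (if b then y else 0#)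
  if-cong true  x≈y = x≈y refl
  if-cong false x≈y = ≈-refl

  if-zero : ∀ b {x} → x ≈ 0# → (if b then x else 0#) ≈ 0#
  if-zero true  x≈0 = x≈0
  if-zero false x≈0 = ≈-refl

  if-+ : ∀ b x y → (if b then x + y else 0#) ≈ (if b then x else 0#) + (if b then y else 0#)
  if-+ true  x y = ≈-refl
  if-+ false x y = ≈-sym (+-identityʳ 0#)

  if-* : ∀ b a x → (if b then a * x else 0#) ≈ a * (if b then x else 0#)
  if-* true  a x = ≈-refl
  if-* false a x = ≈-sym (zeroʳ a)

  sumFin≡sum : ∀ {m} (f : Fin m → Carrier) → sumFin R f ≡ sum f
  sumFin≡sum {zero}  f = refl
  sumFin≡sum {suc m} f = cong (f zero +_) (sumFin≡sum (λ j → f (suc j)))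

  sumFin-cong : ∀ {m} {f g : Fin m → Carrier} → (∀ j → f j ≈ g j) → sumFin R f ≈ sumFin R g
  sumFin-cong {f = f} {g} f≈g = begin
    sumFin R f   ≡⟨ sumFin≡sum f ⟩
    sum f        ≈⟨ sum-cong-≋ f≈g ⟩
    sum g        ≡⟨ sumFin≡sum g ⟨
    sumFin R g   ∎

  sumFin-zero : ∀ {m} {f : Fin m → Carrier} → (∀ j → f j ≈ 0#) → sumFin R f ≈ 0#
  sumFin-zero {m} {f} f≈0 = begin
    sumFin R f              ≈⟨ sumFin-cong f≈0 ⟩
    sumFin R {m} (λ _ → 0#) ≡⟨ sumFin≡sum {m} _ ⟩
    sum {m} (λ _ → 0#)     ≈⟨ sum-replicate-zero m ⟩
    0#                     ∎

  sumFin-+ : ∀ {m} (f g : Fin m → Carrier) → sumFin R (λ j → f j + g j) ≈ sumFin R f + sumFin R g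
  sumFin-+ {m} f g = begin
    sumFin R (λ j → f j + g j)   ≡⟨ sumFin≡sum {m} _ ⟩
    sum (λ j → f j + g j)        ≈⟨ ∑-distrib-+ f g ⟩
    sum f + sum g                ≡⟨ cong₂ _+_ (sumFin≡sum f) (sumFin≡sum g) ⟨
    sumFin R f + sumFin R g      ∎

  *-distribˡ-sumFin : ∀ {m} a (f : Fin m → Carrier) → a * sumFin R f ≈ sumFin R (λ j → a * f j)
  *-distribˡ-sumFin {m} a f = begin
    a * sumFin R f                ≡⟨ cong (a *_) (sumFin≡sum f) ⟩
    a * sum f                     ≈⟨ *-distribˡ-sum a f ⟩
    sum (λ j → a * f j)           ≡⟨ sumFin≡sum {m} _ ⟨
    sumFin R (λ j → a * f j)      ∎

  sumFin-init-last : ∀ {m} (f : Fin (suc m) → Carrier) →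
                     sumFin R f ≈ sumFin R (λ j → f (inject₁ j)) + f (fromℕ m)
  sumFin-init-last {m} f = begin
    sumFin R f                                   ≡⟨ sumFin≡sum f ⟩
    sum f                                        ≈⟨ sum-init-last f ⟩
    sum (λ j → f (inject₁ j)) + f (fromℕ m)      ≡⟨ cong (_+ f (fromℕ m)) (sumFin≡sum {m} _) ⟨
    sumFin R (λ j → f (inject₁ j)) + f (fromℕ m) ∎

  sum1to-cong : ∀ t {f g : ℕ → Carrier} → (∀ k → f k ≈ g k) → sum1to R t f ≈ sum1to R t g
  sum1to-cong zero    f≈g = ≈-refl
  sum1to-cong (suc t) f≈g = +-cong (sum1to-cong t f≈g) (f≈g (suc t))

  sum1to-- : ∀ t (f g : ℕ → Carrier) → sum1to R t (λ k → f k - g k) ≈ sum1to R t f - sum1to R t g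
  sum1to-- zero    f g = ≈-sym (-‿inverseʳ 0#)
  sum1to-- (suc t) f g = begin
    sum1to R t (λ k → f k - g k) + (f (suc t) - g (suc t))
      ≈⟨ +-congʳ (sum1to-- t f g) ⟩
    (sum1to R t f - sum1to R t g) + (f (suc t) - g (suc t))
      ≈⟨ [x+y]-[u+v]≈[x-u]+[y-v] _ _ _ _ ⟨
    sum1to R (suc t) f - sum1to R (suc t) g
      ∎

  sum1to-telescope : ∀ t (f : ℕ → Carrier) → sum1to R t (λ k → f (suc k) - f k) ≈ f (suc t) - f 1
  sum1to-telescope zero    f = ≈-sym (-‿inverseʳ (f 1))
  sum1to-telescope (suc t) f = begin
    sum1to R t (λ k → f (suc k) - f k) + (f (suc (suc t)) - f (suc t))
      ≈⟨ +-congʳ (sum1to-telescope t f) ⟩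
    (f (suc t) - f 1) + (f (suc (suc t)) - f (suc t))
      ≈⟨ [y-x]+[z-y]≈z-x (f 1) (f (suc t)) (f (suc (suc t))) ⟩
    f (suc (suc t)) - f 1
      ∎

  infix 4 _≋_

  _≋_ : ∀ {m} → Form R m → Form R m → Set ℓ
  ω ≋ η = ∀ I n → ω I n ≈ η I n

  0ᶠ : ∀ {m} → Form R m
  0ᶠ _ _ = 0#

  signed : ∀ {m} → Form R m → Form R m
  signed ω I n = sgn R ∣ I ∣ * ω I n

  D-cong : ∀ {m} {ω η : Form R m} → ω ≋ η → D R ω ≋ D R η
  D-cong ω≋η J n = sumFin-cong λ j →
    if-cong (lookup J j) λ _ → *-congˡ (+-cong (ω≋η _ _) (-‿cong (ω≋η _ _)))

  D-0ᶠ : ∀ {m} → D R {m} 0ᶠ ≋ 0ᶠ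
  D-0ᶠ J n = sumFin-zero λ j →
    if-zero (lookup J j) (≈-trans (*-congˡ (-‿inverseʳ 0#)) (zeroʳ _))

  D-⊕ : ∀ {m} (ω η : Form R m) → D R (_⊕_ R ω η) ≋ _⊕_ R (D R ω) (D R η)
  D-⊕ {m} ω η J n = ≈-trans (sumFin-cong term) (sumFin-+ {m} _ _)
    where
    term : ∀ j → dx∧ R j (∂ R j (_⊕_ R ω η)) J n ≈ dx∧ R j (∂ R j ω) J n + dx∧ R j (∂ R j η) J n
    term j = ≈-trans
      (if-cong (lookup J j) λ _ →
        ≈-trans (*-congˡ ([x+y]-[u+v]≈[x-u]+[y-v] _ _ _ _)) (distribˡ _ _ _))
      (if-+ (lookup J j) _ _)

  D-sum1to : ∀ {m} t (φ : ℕ → Form R m) →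
             D R (λ I n → sum1to R t (λ k → φ k I n)) ≋ λ I n → sum1to R t (λ k → D R (φ k) I n)
  D-sum1to zero    φ = D-0ᶠ
  D-sum1to (suc t) φ J n = ≈-trans (D-⊕ (λ I n → sum1to R t (λ k → φ k I n)) (φ (suc t)) J n)
                                   (+-congʳ (D-sum1to t φ J n))

  D-signed : ∀ {m} (ω : Form R m) J n → D R (signed ω) J n ≈ sgn R (suc ∣ J ∣) * D R ω J n
  D-signed {m} ω J n = ≈-trans (sumFin-cong term) (≈-sym (*-distribˡ-sumFin {m} _ _))
    where
    term : ∀ j → dx∧ R j (∂ R j (signed ω)) J n ≈ sgn R (suc ∣ J ∣) * dx∧ R j (∂ R j ω) J n
    term j = ≈-trans (if-cong (lookup J j) signedTerm) (if-* (lookup J j) _ _)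
      where
      J′ = J [ j ]≔ false
      a  = sgn R (countBelow j J)
      x  = ω J′ (shift j n)
      y  = ω J′ n
      signedTerm : lookup J j ≡ true →
                   a * (sgn R ∣ J′ ∣ * x - sgn R ∣ J′ ∣ * y) ≈ sgn R (suc ∣ J ∣) * (a * (x - y))
      signedTerm J[j] = begin
        a * (sgn R ∣ J′ ∣ * x - sgn R ∣ J′ ∣ * y)  ≈⟨ *-congˡ (x[y-z]≈xy-xz _ x y) ⟨
        a * (sgn R ∣ J′ ∣ * (x - y))               ≈⟨ x∙yz≈y∙xz a _ _ ⟩
        sgn R ∣ J′ ∣ * (a * (x - y))               ≈⟨ *-congʳ (sgn-suc-suc ∣ J′ ∣) ⟨
        sgn R (suc (suc ∣ J′ ∣)) * (a * (x - y))
          ≡⟨ cong (λ k → sgn R (suc k) * (a * (x - y))) (∣J∣≡suc∣J[j]≔false∣ J j J[j]) ⟨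
        sgn R (suc ∣ J ∣) * (a * (x - y))          ∎

  -- slice ω false t J n = f_J(n,t) and gSlice ω k J n = g_J(n,k).
  slice : ∀ {d} → Form R (suc d) → Bool → ℕ → Form R d
  slice ω b t J n = ω (J ∷ʳ b) (n ∷ʳ t)

  gSlice : ∀ {d} → Form R (suc d) → ℕ → Form R d
  gSlice ω k J n = gCoeff R ω J (n ∷ʳ k)

  gSlice≋signed-slice : ∀ {d} (ω : Form R (suc d)) k → gSlice ω k ≋ signed (slice ω true k)
  gSlice≋signed-slice ω k J n =
    reflexive (cong (λ c → sgn R c * ω (J ∷ʳ true) (n ∷ʳ k)) (countBelow-∷ʳ-fromℕ J true))

  dx∧-∂-∷ʳ-inject₁ : ∀ {d} (ω : Form R (suc d)) J b n t (j : Fin d) →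
    dx∧ R (inject₁ j) (∂ R (inject₁ j) ω) (J ∷ʳ b) (n ∷ʳ t) ≡ dx∧ R j (∂ R j (slice ω b t)) J n
  dx∧-∂-∷ʳ-inject₁ ω J b n t j
    rewrite lookup-∷ʳ-inject₁ J b j | countBelow-∷ʳ-inject₁ J b j
          | updateAt-∷ʳ-inject₁ J b j (λ _ → false) | updateAt-∷ʳ-inject₁ n t j suc = refl

  dx∧-∂-∷ʳ-fromℕ : ∀ {d} (ω : Form R (suc d)) J b n t →
    dx∧ R (fromℕ d) (∂ R (fromℕ d) ω) (J ∷ʳ b) (n ∷ʳ t)
      ≡ (if b then sgn R ∣ J ∣ * (slice ω false (suc t) J n - slice ω false t J n) else 0#)
  dx∧-∂-∷ʳ-fromℕ ω J b n t
    rewrite lookup-∷ʳ-fromℕ J b | countBelow-∷ʳ-fromℕ J b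
          | updateAt-∷ʳ-fromℕ J b (λ _ → false) | updateAt-∷ʳ-fromℕ n t suc = refl

  D-∷ʳ : ∀ {d} (ω : Form R (suc d)) J b n t →
    D R ω (J ∷ʳ b) (n ∷ʳ t)
      ≈ D R (slice ω b t) J n
        + (if b then sgn R ∣ J ∣ * (slice ω false (suc t) J n - slice ω false t J n) else 0#)
  D-∷ʳ ω J b n t = ≈-trans (sumFin-init-last (λ j → dx∧ R j (∂ R j ω) (J ∷ʳ b) (n ∷ʳ t)))
    (+-cong (sumFin-cong λ j → reflexive (dx∧-∂-∷ʳ-inject₁ ω J b n t j))
            (reflexive (dx∧-∂-∷ʳ-fromℕ ω J b n t)))

  K-∷ʳ-true : ∀ {d} (ω : Form R (suc d)) J p → K R ω (J ∷ʳ true) p ≡ 0#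
  K-∷ʳ-true ω J p rewrite last-∷ʳ true J = refl

  K-∷ʳ-false : ∀ {d} (ω : Form R (suc d)) J n m →
               K R ω (J ∷ʳ false) (n ∷ʳ suc m) ≡ sum1to R m (λ k → gSlice ω k J n)
  K-∷ʳ-false ω J n m
    rewrite last-∷ʳ false J | last-∷ʳ (suc m) n | init-∷ʳ false J | init-∷ʳ (suc m) n = refl

  π*s*-∷ʳ-true : ∀ {d} (ω : Form R (suc d)) J p → π* R (s* R ω) (J ∷ʳ true) p ≡ 0#
  π*s*-∷ʳ-true ω J p rewrite last-∷ʳ true J = refl

  π*s*-∷ʳ-false : ∀ {d} (ω : Form R (suc d)) J n t →
                  π* R (s* R ω) (J ∷ʳ false) (n ∷ʳ t) ≡ slice ω false 1 J n
  π*s*-∷ʳ-false ω J n t rewrite last-∷ʳ false J | init-∷ʳ false J | init-∷ʳ t n = refl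

  slice-K-true : ∀ {d} (ω : Form R (suc d)) t → slice (K R ω) true t ≋ 0ᶠ
  slice-K-true ω t J n = reflexive (K-∷ʳ-true ω J (n ∷ʳ t))

  slice-K-false : ∀ {d} (ω : Form R (suc d)) m →
                  slice (K R ω) false (suc m) ≋ λ J n → sum1to R m (λ k → gSlice ω k J n)
  slice-K-false ω m J n = reflexive (K-∷ʳ-false ω J n m)

  gSlice-D : ∀ {d} (ω : Form R (suc d)) k J n →
    gSlice (D R ω) k J n ≈ (slice ω false (suc k) J n - slice ω false k J n) - D R (gSlice ω k) J n
  gSlice-D ω k J n = begin
    gSlice (D R ω) k J n                           ≈⟨ gSlice≋signed-slice (D R ω) k J n ⟩
    ε * D R ω (J ∷ʳ true) (n ∷ʳ k)                 ≈⟨ *-congˡ (D-∷ʳ ω J true n k) ⟩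
    ε * (Dᵥ + ε * Δ)                               ≈⟨ distribˡ ε Dᵥ (ε * Δ) ⟩
    ε * Dᵥ + ε * (ε * Δ)                           ≈⟨ +-congˡ (sgn-cancel ∣ J ∣ Δ) ⟩
    ε * Dᵥ + Δ                                     ≈⟨ +-comm _ Δ ⟩
    Δ + ε * Dᵥ                                     ≈⟨ +-congˡ (⁻¹-involutive (ε * Dᵥ)) ⟨
    Δ - - (ε * Dᵥ)                                 ≈⟨ +-congˡ (-‿cong (-‿distribˡ-* ε Dᵥ)) ⟩
    Δ - (sgn R (suc ∣ J ∣) * Dᵥ)                   ≈⟨ +-congˡ (-‿cong (D-signed (slice ω true k) J n)) ⟨
    Δ - D R (signed (slice ω true k)) J n          ≈⟨ +-congˡ (-‿cong (D-cong (gSlice≋signed-slice ω k) J n)) ⟨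
    Δ - D R (gSlice ω k) J n                       ∎
    where
    ε  = sgn R ∣ J ∣
    Dᵥ = D R (slice ω true k) J n
    Δ  = slice ω false (suc k) J n - slice ω false k J n

  homotopy-vertical : ∀ {d} (ω : Form R (suc d)) J n m →
    _⊖_ R ω (π* R (s* R ω)) (J ∷ʳ true) (n ∷ʳ suc m)
      ≈ _⊕_ R (D R (K R ω)) (K R (D R ω)) (J ∷ʳ true) (n ∷ʳ suc m)
  homotopy-vertical ω J n m = begin
    W - π* R (s* R ω) (J ∷ʳ true) (n ∷ʳ suc m)
      ≡⟨ cong (λ x → W - x) (π*s*-∷ʳ-true ω J (n ∷ʳ suc m)) ⟩
    W - 0#                                       ≈⟨ +-congˡ ε⁻¹≈ε ⟩
    W + 0#                                       ≈⟨ +-identityʳ W ⟩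
    W                                            ≈⟨ sgn-cancel ∣ J ∣ W ⟨
    ε * (ε * W)                                  ≈⟨ *-congˡ (gSlice≋signed-slice ω (suc m) J n) ⟨
    ε * gSlice ω (suc m) J n                     ≈⟨ *-congˡ ([x+y]-x≈y _ _) ⟨
    ε * (sum1to R (suc m) g - sum1to R m g)
      ≡⟨ cong₂ (λ x y → ε * (x - y)) (K-∷ʳ-false ω J n (suc m)) (K-∷ʳ-false ω J n m) ⟨
    ε * (slice (K R ω) false (suc (suc m)) J n - slice (K R ω) false (suc m) J n)
                                                 ≈⟨ +-identityˡ _ ⟨
    0# + ε * (slice (K R ω) false (suc (suc m)) J n - slice (K R ω) false (suc m) J n)
                                                 ≈⟨ +-congʳ (≈-trans (D-cong (slice-K-true ω (suc m)) J n) (D-0ᶠ J n)) ⟨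
    D R (slice (K R ω) true (suc m)) J n
      + ε * (slice (K R ω) false (suc (suc m)) J n - slice (K R ω) false (suc m) J n)
                                                 ≈⟨ D-∷ʳ (K R ω) J true n (suc m) ⟨
    D R (K R ω) (J ∷ʳ true) (n ∷ʳ suc m)         ≈⟨ +-identityʳ _ ⟨
    D R (K R ω) (J ∷ʳ true) (n ∷ʳ suc m) + 0#
      ≡⟨ cong (D R (K R ω) (J ∷ʳ true) (n ∷ʳ suc m) +_) (K-∷ʳ-true (D R ω) J (n ∷ʳ suc m)) ⟨
    D R (K R ω) (J ∷ʳ true) (n ∷ʳ suc m) + K R (D R ω) (J ∷ʳ true) (n ∷ʳ suc m) ∎
    where
    ε = sgn R ∣ J ∣
    W = ω (J ∷ʳ true) (n ∷ʳ suc m)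
    g = λ k → gSlice ω k J n

  homotopy-horizontal : ∀ {d} (ω : Form R (suc d)) J n m →
    _⊖_ R ω (π* R (s* R ω)) (J ∷ʳ false) (n ∷ʳ suc m)
      ≈ _⊕_ R (D R (K R ω)) (K R (D R ω)) (J ∷ʳ false) (n ∷ʳ suc m)
  homotopy-horizontal ω J n m = ≈-sym (begin
    D R (K R ω) (J ∷ʳ false) (n ∷ʳ suc m) + K R (D R ω) (J ∷ʳ false) (n ∷ʳ suc m)
      ≈⟨ +-cong (D-∷ʳ (K R ω) J false n (suc m)) (reflexive (K-∷ʳ-false (D R ω) J n m)) ⟩
    (D R (slice (K R ω) false (suc m)) J n + 0#) + sum1to R m (λ k → gSlice (D R ω) k J n)
      ≈⟨ +-cong (+-congʳ (≈-trans (D-cong (slice-K-false ω m) J n) (D-sum1to m (gSlice ω) J n)))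
                (sum1to-cong m λ k → gSlice-D ω k J n) ⟩
    (sum1to R m X + 0#) + sum1to R m (λ k → (F (suc k) - F k) - X k)
      ≈⟨ +-cong (+-identityʳ _) (≈-trans (sum1to-- m _ X) (+-congʳ (sum1to-telescope m F))) ⟩
    sum1to R m X + ((F (suc m) - F 1) - sum1to R m X)
      ≈⟨ x+[y-x]≈y _ _ ⟩
    F (suc m) - F 1
      ≡⟨ cong (λ x → F (suc m) - x) (π*s*-∷ʳ-false ω J n (suc m)) ⟨
    F (suc m) - π* R (s* R ω) (J ∷ʳ false) (n ∷ʳ suc m) ∎)
    where
    F = λ k → slice ω false k J n
    X = λ k → D R (gSlice ω k) J n

  homotopy-∷ʳ : ∀ {d} (ω : Form R (suc d)) J b n t → 1 ≤ t →
    _⊖_ R ω (π* R (s* R ω)) (J ∷ʳ b) (n ∷ʳ t) ≈ _⊕_ R (D R (K R ω)) (K R (D R ω)) (J ∷ʳ b) (n ∷ʳ t)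
  homotopy-∷ʳ ω J true  n (suc m) _ = homotopy-vertical ω J n m
  homotopy-∷ʳ ω J false n (suc m) _ = homotopy-horizontal ω J n m

  homotopy : ∀ {d} (ω : Form R (suc d)) {I p} →
    (∃₂ λ J b → I ≡ J ∷ʳ b) → (∃₂ λ n t → p ≡ n ∷ʳ t) → Positive p →
    _⊖_ R ω (π* R (s* R ω)) I p ≈ _⊕_ R (D R (K R ω)) (K R (D R ω)) I p
  homotopy ω (J , b , refl) (n , t , refl) pos = homotopy-∷ʳ ω J b n t (last-positive n t pos)

proposition2 : ∀ {c ℓ : Level} (R : CommutativeRing c ℓ) (d : ℕ) → 1 ≤ d →
    ∀ (q : ℕ) → q ≤ suc d → ∀ (ω : Form R (suc d)) → HasDegree R q ω →
    ∀ (I : Subset (suc d)) (p : Pt (suc d)) → Positive p →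
    CommutativeRing._≈_ R ((_⊖_ R ω (π* R (s* R ω))) I p)
      ((_⊕_ R (D R (K R ω)) (K R (D R ω))) I p)
proposition2 R _ _ _ _ ω _ I p pos = homotopy R ω (initLast I) (initLast p) pos
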